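{- Let $w$ be an involution of size $n$ with $w\neq e_n$, and let $M_w$ be the set of maximal elements (with respect to the middle order) of the set of slow-climbing involutions $v$ with $v\le w$ in $\mathcal{P}_n$. Then there exists an index $i$ such that the $i$th entry of $I(v)$ is nonzero for every $v\in M_w$. Equivalently, the meet $\bigwedge M_w$ in $\mathcal{P}_n$ is different from $e_n$.
   Context: $e_n$ is the identity permutation of size $n$. For $w\in S_n$ (one-line notation), its inversion sequence is $I(w)=(x_1,\ldots,x_n)$ with $x_i=\#\{j<i : w^{ -1}(j)>w^{ -1}(i)\}$. The middle order $\mathcal{P}_n$ is the lattice on $S_n$ with $v\le w$ iff $I(v)\le I(w)$ coordinate-wise; meets are coordinate-wise minima of inversion sequences. For an inversion sequence $x$, an index $i$ is an ascent if $x_i<x_{i+1}$, a small ascent if $x_{i+1}=x_i+1$, and a large ascent otherwise; $x$ is slow-climbing if it has no large ascents. A permutation is slow-climbing if its inversion sequence is. -}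

module Defs where

open import Data.Nat using (ℕ; zero; suc; _≤_; _<_)
open import Data.Fin using (Fin; toℕ; _<?_)
open import Data.List using (List; length; filterᵇ; allFin)
open import Data.Bool using (_∧_)
open import Data.Product using (_×_)
open import Relation.Nullary using (¬_; does)
open import Relation.Binary.PropositionalEquality using (_≡_; _≢_)
open import Data.Fin.Permutation using (Permutation′; _⟨$⟩ʳ_; _⟨$⟩ˡ_)

-- Permutations of size n are bijections Fin n ↔ Fin n (0-indexed).
-- w ⟨$⟩ʳ i is w(i) (one-line notation), w ⟨$⟩ˡ i is w⁻¹(i).

I : ∀ {n} → Permutation′ n → Fin n → ℕ
I {n} w i = length (filterᵇ
  (λ j → does (j <? i) ∧ does ((w ⟨$⟩ˡ i) <? (w ⟨$⟩ˡ j))) (allFin n))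

IsIdentity : ∀ {n} → Permutation′ n → Set
IsIdentity {n} w = ∀ (i : Fin n) → w ⟨$⟩ʳ i ≡ i

IsInvolution : ∀ {n} → Permutation′ n → Set
IsInvolution {n} w = ∀ (i : Fin n) → w ⟨$⟩ʳ (w ⟨$⟩ʳ i) ≡ i

_≤ₘ_ : ∀ {n} → Permutation′ n → Permutation′ n → Set
_≤ₘ_ {n} v w = ∀ (i : Fin n) → I v i ≤ I w i

LargeAscentAt : ∀ {n} → (Fin n → ℕ) → Fin n → Fin n → Set
LargeAscentAt x i j = (toℕ j ≡ suc (toℕ i)) × (x i < x j) × (x j ≢ suc (x i))

SlowClimbingSeq : ∀ {n} → (Fin n → ℕ) → Set
SlowClimbingSeq {n} x = ∀ (i j : Fin n) → ¬ LargeAscentAt x i j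

SlowClimbing : ∀ {n} → Permutation′ n → Set
SlowClimbing w = SlowClimbingSeq (I w)

InS : ∀ {n} → Permutation′ n → Permutation′ n → Set
InS w v = SlowClimbing v × IsInvolution v × (v ≤ₘ w)

InM : ∀ {n} → Permutation′ n → Permutation′ n → Set
InM {n} w v = InS w v × (∀ (u : Permutation′ n) → InS w u → v ≤ₘ u → u ≤ₘ v)

-- Let m be the last point moved by w and suppose some v ∈ M_w has I(v)_m = 0.  As I(w) vanishes
-- beyond m and v ≤ w, v fixes every point ≥ m.  Put L = m − 1 and p = v(L).  The count I(v) is 0
-- at p (v(p) = L exceeds every earlier value) and L − p at L, and a slow-climbing sequence rises
-- by at most one per step, so it rises by exactly one per step on [p, L].  Hence v descends along
-- [p, L], and descending from L to p in L − p steps it reverses that block.  Reversing the longer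
-- block [p, m] instead yields a slow-climbing involution u with the inversion sequence of v except
-- for I(u)_m = m − p > 0; and u ≤ w since I(w)_m = m − w(m) with w(m) ≤ p.  Thus v < u ≤ w,
-- contradicting the maximality of v.
module Submission where

open import Defs
open import Data.Nat using (ℕ; zero; suc; _+_; _∸_; _≤_; _<_; _≤?_; z≤n; s≤s; s≤s⁻¹)
import Data.Nat as ℕ
open import Data.Nat.Properties hiding (_<?_; _≟_)
open import Data.Bool using (Bool; true; false; T; _∧_; not)
open import Data.Bool.Properties using (T-∧)
open import Data.Fin using (Fin; toℕ; fromℕ<; _<?_)
  renaming (zero to fzero; suc to fsuc; _<_ to _<ᶠ_; _≤_ to _≤ᶠ_)
open import Data.Fin.Properties using (all?; _≟_; toℕ-injective; toℕ-fromℕ<; fromℕ<-toℕ; toℕ<n)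
open import Data.Fin.Permutation
  using (Permutation′; permutation; _⟨$⟩ʳ_; _⟨$⟩ˡ_; inverseˡ; inverseʳ)
open import Data.List using (List; []; _∷_; length; filterᵇ; map; tabulate; allFin)
open import Data.List.Properties using (map-tabulate; filter-none; filter-some)
open import Data.List.Membership.Propositional using (_∈_)
open import Data.List.Membership.Propositional.Properties using (∈-allFin; ∈-map⁺)
open import Data.List.Membership.Propositional.Properties.WithK using (unique∧set⇒bag)
import Data.List.Relation.Unary.Any as Any
import Data.List.Relation.Unary.All as All
open import Data.List.Relation.Unary.Unique.Propositional.Properties using (allFin⁺; map⁺)
open import Data.List.Relation.Binary.BagAndSetEquality using (∼bag⇒↭)
open import Data.List.Relation.Binary.Permutation.Propositional using (_↭_; ↭-sym)
open import Data.List.Relation.Binary.Permutation.Propositional.Properties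
  using (filter-↭; ↭-length)
open import Data.Product using (∃; _×_; _,_; proj₁; proj₂)
open import Data.Sum using (inj₁; inj₂)
open import Function using (_∘_; _⇔_; mk⇔; Equivalence)
open import Relation.Nullary using (¬_; Dec; does; yes; no; contradiction)
open import Relation.Nullary.Decidable using (T?; _×-dec_)
open import Relation.Binary.Definitions using (Tri; tri<; tri≈; tri>)
open import Relation.Binary.PropositionalEquality
open ≡-Reasoning
open Equivalence using (to; from)

count : ∀ {A : Set} → (A → Bool) → List A → ℕ
count p xs = length (filterᵇ p xs)

module _ {A : Set} where

  count-mono : ∀ {p q : A → Bool} → (∀ x → T (p x) → T (q x)) → ∀ xs → count p xs ≤ count q xs
  count-mono p⇒q [] = z≤n
  count-mono {p} {q} p⇒q (x ∷ xs) with p x in px | q x in qx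
  ... | true  | true  = s≤s (count-mono p⇒q xs)
  ... | false | true  = m≤n⇒m≤1+n (count-mono p⇒q xs)
  ... | false | false = count-mono p⇒q xs
  ... | true  | false = contradiction (subst T qx (p⇒q x (subst T (sym px) _))) λ ()

  count-cong : ∀ {p q : A → Bool} → (∀ x → T (p x) ⇔ T (q x)) → ∀ xs → count p xs ≡ count q xs
  count-cong p⇔q xs = ≤-antisym (count-mono (to ∘ p⇔q) xs) (count-mono (from ∘ p⇔q) xs)

  count-none : ∀ {p : A → Bool} → (∀ x → ¬ T (p x)) → ∀ xs → count p xs ≡ 0
  count-none {p} ¬p xs = cong length (filter-none (T? ∘ p) {xs} (All.tabulate λ {x} _ → ¬p x))

  count-pos : ∀ {p : A → Bool} {x xs} → x ∈ xs → T (p x) → 0 < count p xs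
  count-pos {p} x∈xs px = filter-some (T? ∘ p) (Any.map (λ { refl → px }) x∈xs)

  count-split : ∀ (p q : A → Bool) xs →
    count p xs ≡ count (λ x → p x ∧ q x) xs + count (λ x → p x ∧ not (q x)) xs
  count-split p q [] = refl
  count-split p q (x ∷ xs) with p x | q x
  ... | true  | true  = cong suc (count-split p q xs)
  ... | true  | false = trans (cong suc (count-split p q xs)) (sym (+-suc _ _))
  ... | false | _     = count-split p q xs

  count-map : ∀ {B : Set} (p : B → Bool) (f : A → B) xs → count p (map f xs) ≡ count (p ∘ f) xs
  count-map p f [] = refl
  count-map p f (x ∷ xs) with p (f x)
  ... | true  = cong suc (count-map p f xs)
  ... | false = count-map p f xs

count-allFin-permute : ∀ {n} (p : Fin n → Bool) (π : Permutation′ n) →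
  count p (allFin n) ≡ count (p ∘ (π ⟨$⟩ʳ_)) (allFin n)
count-allFin-permute {n} p π = begin
  count p (allFin n)                 ≡⟨ ↭-length (filter-↭ (T? ∘ p) (↭-sym π-allFin↭allFin)) ⟩
  count p (map (π ⟨$⟩ʳ_) (allFin n)) ≡⟨ count-map p (π ⟨$⟩ʳ_) (allFin n) ⟩
  count (p ∘ (π ⟨$⟩ʳ_)) (allFin n)   ∎
  where
  π-injective : ∀ {i j} → π ⟨$⟩ʳ i ≡ π ⟨$⟩ʳ j → i ≡ j
  π-injective eq = trans (sym (inverseˡ π)) (trans (cong (π ⟨$⟩ˡ_) eq) (inverseˡ π))
  image : ∀ i → i ∈ map (π ⟨$⟩ʳ_) (allFin n)
  image i = subst (_∈ map (π ⟨$⟩ʳ_) (allFin n)) (inverseʳ π) (∈-map⁺ (π ⟨$⟩ʳ_) (∈-allFin (π ⟨$⟩ˡ i)))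
  π-allFin↭allFin : map (π ⟨$⟩ʳ_) (allFin n) ↭ allFin n
  π-allFin↭allFin = ∼bag⇒↭ (unique∧set⇒bag (map⁺ π-injective (allFin⁺ n)) (allFin⁺ n)
    (λ {i} → mk⇔ (λ _ → ∈-allFin i) (λ _ → image i)))

count-allFin-below : ∀ {n} (e : Fin n) → count (λ j → does (j <? e)) (allFin n) ≡ toℕ e
count-allFin-below {suc n} fzero =
  count-none {p = λ j → does (j <? fzero {n})} (λ _ ()) (allFin (suc n))
count-allFin-below {suc n} (fsuc e) = cong suc (begin
  count p (tabulate fsuc)        ≡⟨ cong (count p) (map-tabulate (λ j → j) fsuc) ⟨
  count p (map fsuc (allFin n))  ≡⟨ count-map p fsuc (allFin n) ⟩
  count (p ∘ fsuc) (allFin n)    ≡⟨ count-allFin-below e ⟩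
  toℕ e                          ∎)
  where
  p : Fin (suc n) → Bool
  p j = does (j <? fsuc e)

<?⇔< : ∀ {n} (x y : Fin n) → T (does (x <? y)) ⇔ x <ᶠ y
<?⇔< x y = mk⇔ (<ᵇ⇒< (toℕ x) (toℕ y)) <⇒<ᵇ

T-not⇔¬T : ∀ {b} → T (not b) ⇔ (¬ T b)
T-not⇔¬T {true}  = mk⇔ (λ ()) (λ ¬t → ¬t _)
T-not⇔¬T {false} = mk⇔ (λ _ ()) (λ _ → _)

last-counterexample : ∀ {n} {P : Fin n → Set} → (∀ i → Dec (P i)) → ¬ (∀ i → P i) →
  ∃ λ m → ¬ P m × (∀ k → m <ᶠ k → P k)
last-counterexample {zero}  P? ¬all = contradiction (λ ()) ¬all
last-counterexample {suc n} P? ¬all with all? (P? ∘ fsuc)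
... | yes all-suc = fzero , (λ P0 → ¬all λ { fzero → P0 ; (fsuc i) → all-suc i }) ,
                    λ { fzero () ; (fsuc k) _ → all-suc k }
... | no ¬all-suc = let m , ¬Pm , above = last-counterexample (P? ∘ fsuc) ¬all-suc in
                    fsuc m , ¬Pm , λ { fzero () ; (fsuc k) (s≤s m<k) → above k m<k }

module _ (y : ℕ → ℕ) (step : ∀ k → y (suc k) ≤ suc (y k)) where

  climb-bound : ∀ d a → y (d + a) ≤ d + y a
  climb-bound zero    a = ≤-refl
  climb-bound (suc d) a = ≤-trans (step (d + a)) (s≤s (climb-bound d a))

  climb-bound-flat : ∀ d a i → i < d → y (suc (i + a)) ≤ y (i + a) → y (d + a) < d + y a
  climb-bound-flat (suc d) a i i<1+d flat with m<1+n⇒m<n∨m≡n i<1+d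
  ... | inj₂ refl = s≤s (≤-trans flat (climb-bound d a))
  ... | inj₁ i<d  = ≤-trans (s≤s (step (d + a))) (s≤s (climb-bound-flat d a i i<d flat))

  climb-steep : ∀ d a → d + y a ≤ y (d + a) → ∀ i → i < d → y (i + a) < y (suc (i + a))
  climb-steep d a rise i i<d = ≰⇒> λ flat → <⇒≱ (climb-bound-flat d a i i<d flat) rise

module _ (z : ℕ → ℕ) where

  descent-bound : ∀ d a → (∀ i → i < d → z (suc (i + a)) < z (i + a)) → d + z (d + a) ≤ z a
  descent-bound zero    a desc = ≤-refl
  descent-bound (suc d) a desc =
    ≤-trans (≤-reflexive (sym (+-suc d _))) (≤-trans (+-monoʳ-≤ d (desc d ≤-refl))
      (descent-bound d a (λ i i<d → desc i (m≤n⇒m≤1+n i<d))))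

  descent-exact : ∀ d a → (∀ i → i < d → z (suc (i + a)) < z (i + a)) → z a ≤ d + z (d + a) →
    ∀ i → i ≤ d → i + z (i + a) ≡ z a
  descent-exact d a desc drop i i≤d with m≤n⇒m<n∨m≡n i≤d
  ... | inj₂ refl = ≤-antisym (descent-bound d a desc) drop
  descent-exact (suc d) a desc drop i i≤d | inj₁ (s≤s i≤d′) =
    descent-exact d a (λ j j<d → desc j (m≤n⇒m≤1+n j<d))
      (≤-trans drop (≤-trans (≤-reflexive (sym (+-suc d _))) (+-monoʳ-≤ d (desc d ≤-refl)))) i i≤d′

mirror-bounds : ∀ {x s a b} → x + s ≡ a + b → a ≤ s → s ≤ b → a ≤ x × x ≤ b
mirror-bounds {x} {s} {a} {b} eq a≤s s≤b =
  +-cancelʳ-≤ s a x (subst (a + s ≤_) (sym eq) (+-monoʳ-≤ a s≤b)) ,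
  +-cancelʳ-≤ s x b (subst (_≤ b + s) (sym eq) (subst (a + b ≤_) (+-comm s b) (+-monoˡ-≤ b a≤s)))

mirror-< : ∀ {x s a b} → x + s ≡ a + b → a < s → x < b
mirror-< {x} {s} {a} {b} eq a<s =
  +-cancelʳ-< s x b (subst (_< b + s) (sym eq) (subst (a + b <_) (+-comm s b) (+-monoˡ-< b a<s)))

bump : ℕ → ℕ → ℕ → ℕ
bump a b x with (a ≤? x) ×-dec (x ≤? b)
... | yes _ = suc x
... | no  _ = x

bump-inside : ∀ {a b x} → a ≤ x → x ≤ b → bump a b x ≡ suc x
bump-inside {a} {b} {x} a≤x x≤b with (a ≤? x) ×-dec (x ≤? b)
... | yes _  = refl
... | no  x∉ = contradiction (a≤x , x≤b) x∉

bump-outside : ∀ {a b x} → ¬ (a ≤ x × x ≤ b) → bump a b x ≡ x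
bump-outside {a} {b} {x} x∉ with (a ≤? x) ×-dec (x ≤? b)
... | yes x∈ = contradiction x∈ x∉
... | no  _  = refl

bump-mono : ∀ {a b x y} → x < y → y ≢ suc b → bump a b x < bump a b y
bump-mono {a} {b} {x} {y} x<y y≢1+b with (a ≤? x) ×-dec (x ≤? b) | (a ≤? y) ×-dec (y ≤? b)
... | yes _           | yes _ = s≤s x<y
... | no  _           | yes _ = <-trans x<y (n<1+n y)
... | no  _           | no  _ = x<y
... | yes (a≤x , x≤b) | no y∉ = ≤-trans (s≤s (s≤s x≤b)) 1+b<y
  where
  b<y : b < y
  b<y = ≰⇒> (λ y≤b → y∉ (≤-trans a≤x (<⇒≤ x<y) , y≤b))
  1+b<y : suc b < y
  1+b<y = ≤∧≢⇒< b<y (≢-sym y≢1+b)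

bump-<⇔ : ∀ {a b x y} → x ≢ suc b → y ≢ suc b → (bump a b x < bump a b y ⇔ x < y)
bump-<⇔ {a} {b} {x} {y} x≢1+b y≢1+b = mk⇔ reflect (λ x<y → bump-mono x<y y≢1+b)
  where
  reflect : bump a b x < bump a b y → x < y
  reflect bx<by with <-cmp x y
  ... | tri< x<y _ _  = x<y
  ... | tri≈ _ refl _ = contradiction bx<by (<-irrefl refl)
  ... | tri> _ _ y<x  = contradiction bx<by (<-asym (bump-mono y<x x≢1+b))

module _ {n : ℕ} where

  open import Algebra.Definitions {A = Fin n} _≡_ using (Involutive)

  -- I π is by definition inversions (π ⟨$⟩ˡ_).
  inverted : (Fin n → Fin n) → Fin n → Fin n → Bool
  inverted f i j = does (j <? i) ∧ does (f i <? f j)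

  inversions : (Fin n → Fin n) → Fin n → ℕ
  inversions f i = count (inverted f i) (allFin n)

  inverted⇔ : ∀ f i j → T (inverted f i j) ⇔ (j <ᶠ i × f i <ᶠ f j)
  inverted⇔ f i j = mk⇔
    (λ t → let a , b = to (T-∧ {does (j <? i)}) t in to (<?⇔< j i) a , to (<?⇔< (f i) (f j)) b)
    (λ (a , b) → from T-∧ (from (<?⇔< j i) a , from (<?⇔< (f i) (f j)) b))

  inversions-pos : ∀ {f j k} → j <ᶠ k → f k <ᶠ f j → 0 < inversions f k
  inversions-pos {f} {j} {k} j<k fk<fj =
    count-pos (∈-allFin j) (from (inverted⇔ f k j) (j<k , fk<fj))

  inversions-zero : ∀ {f k} → (∀ j → j <ᶠ k → f j ≤ᶠ f k) → inversions f k ≡ 0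
  inversions-zero {f} {k} below = count-none (λ j t →
    let j<k , fk<fj = to (inverted⇔ f k j) t in <⇒≱ fk<fj (below j j<k)) (allFin n)

  inversions-cong : ∀ {f g k} → (∀ j → j <ᶠ k → (g k <ᶠ g j ⇔ f k <ᶠ f j)) →
    inversions g k ≡ inversions f k
  inversions-cong {f} {g} {k} agree = count-cong (λ j → mk⇔
    (λ t → let j<k , lt = to (inverted⇔ g k j) t in
           from (inverted⇔ f k j) (j<k , to (agree j j<k) lt))
    (λ t → let j<k , lt = to (inverted⇔ f k j) t in
           from (inverted⇔ g k j) (j<k , from (agree j j<k) lt))) (allFin n)

  inversions-ascent : ∀ {f i j} → toℕ j ≡ suc (toℕ i) → f i <ᶠ f j → inversions f j ≤ inversions f i
  inversions-ascent {f} {i} {j} j≡1+i fi<fj = count-mono earlier (allFin n)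
    where
    earlier : ∀ x → T (inverted f j x) → T (inverted f i x)
    earlier x t = from (inverted⇔ f i x) (x<i , <-trans fi<fj fj<fx)
      where
      x<j = proj₁ (to (inverted⇔ f j x) t)
      fj<fx = proj₂ (to (inverted⇔ f j x) t)
      x<i : x <ᶠ i
      x<i = ≤∧≢⇒< (s≤s⁻¹ (subst (toℕ x <_) j≡1+i x<j))
                  (λ x≡i → <-asym fi<fj (subst (λ y → f j <ᶠ f y) (toℕ-injective x≡i) fj<fx))

  involutive-injective : ∀ {f} → Involutive f → ∀ {x y} → f x ≡ f y → x ≡ y
  involutive-injective {f} inv {x} {y} fx≡fy = trans (sym (inv x)) (trans (cong f fx≡fy) (inv y))

  involution : ∀ f → Involutive f → Permutation′ n
  involution f inv = permutation f f inv inv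

  involution-from≗to : ∀ {π : Permutation′ n} → IsInvolution π → ∀ i → π ⟨$⟩ˡ i ≡ π ⟨$⟩ʳ i
  involution-from≗to {π} π-inv i = trans (cong (π ⟨$⟩ˡ_) (sym (π-inv i))) (inverseˡ π)

  involution-involutive : ∀ {π : Permutation′ n} → IsInvolution π → Involutive (π ⟨$⟩ˡ_)
  involution-involutive {π} π-inv i =
    trans (cong (π ⟨$⟩ˡ_) (involution-from≗to {π} π-inv i)) (inverseˡ π)

  FixedAbove : (Fin n → Fin n) → Fin n → Set
  FixedAbove f e = ∀ x → e <ᶠ x → f x ≡ x

  fixedAbove-≤ : ∀ {f e} → Involutive f → FixedAbove f e → ∀ {x} → x ≤ᶠ e → f x ≤ᶠ e
  fixedAbove-≤ {f} {e} inv fix {x} x≤e = ≮⇒≥ λ e<fx →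
    <⇒≱ e<fx (subst (_≤ᶠ e) (trans (sym (inv x)) (fix (f x) e<fx)) x≤e)

  -- Reindexed by f, the non-inverted j < e are exactly the values below f e.
  inversions-top : ∀ {f e} → Involutive f → FixedAbove f e → inversions f e + toℕ (f e) ≡ toℕ e
  inversions-top {f} {e} inv fix = begin
    inversions f e + toℕ (f e)                        ≡⟨ cong (inversions f e +_) non-inverted ⟨
    inversions f e + count below∧¬inverted (allFin n) ≡⟨ count-split below inverted-at (allFin n) ⟨
    count below (allFin n)                            ≡⟨ count-allFin-below e ⟩
    toℕ e                                             ∎
    where
    below inverted-at below∧¬inverted : Fin n → Bool
    below j = does (j <? e)
    inverted-at j = does (f e <? f j)
    below∧¬inverted j = below j ∧ not (inverted-at j)
    forth : ∀ {j} → T (below∧¬inverted j) → f j <ᶠ f e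
    forth {j} t = ≤∧≢⇒< (≮⇒≥ (to T-not⇔¬T ¬fe<fj ∘ from (<?⇔< (f e) (f j))))
                        (λ fj≡fe → <-irrefl (cong toℕ (j≡e fj≡fe)) (to (<?⇔< j e) j<e))
      where
      j<e = proj₁ (to (T-∧ {below j}) t)
      ¬fe<fj = proj₂ (to (T-∧ {below j}) t)
      j≡e : toℕ (f j) ≡ toℕ (f e) → j ≡ e
      j≡e = involutive-injective {f} inv ∘ toℕ-injective
    back : ∀ {j} → f j <ᶠ f e → T (below∧¬inverted j)
    back {j} fj<fe = from T-∧ (from (<?⇔< j e) j<e ,
                               from T-not⇔¬T (<-asym fj<fe ∘ to (<?⇔< (f e) (f j))))
      where
      fj≤e : f j ≤ᶠ e
      fj≤e = <⇒≤ (≤-trans fj<fe (fixedAbove-≤ {f} inv fix {e} ≤-refl))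
      j<e : j <ᶠ e
      j<e = ≤∧≢⇒< (subst (_≤ᶠ e) (inv j) (fixedAbove-≤ {f} inv fix fj≤e))
                  (λ j≡e → <-irrefl (cong (toℕ ∘ f) (toℕ-injective j≡e)) fj<fe)
    non-inverted : count below∧¬inverted (allFin n) ≡ toℕ (f e)
    non-inverted = begin
      count below∧¬inverted (allFin n)      ≡⟨ count-cong value-below (allFin n) ⟩
      count (below-fe ∘ f) (allFin n)       ≡⟨ count-allFin-permute below-fe (involution f inv) ⟨
      count below-fe (allFin n)             ≡⟨ count-allFin-below (f e) ⟩
      toℕ (f e)                             ∎
      where
      below-fe : Fin n → Bool
      below-fe x = does (x <? f e)
      value-below : ∀ j → T (below∧¬inverted j) ⇔ T (below-fe (f j))
      value-below j = mk⇔ (from (<?⇔< (f j) (f e)) ∘ forth) (back ∘ to (<?⇔< (f j) (f e)))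

  inversions-fixed : ∀ {f e} → Involutive f → FixedAbove f e → f e ≡ e → inversions f e ≡ 0
  inversions-fixed {f} {e} inv fix fe≡e = +-cancelʳ-≡ (toℕ e) (inversions f e) 0
    (subst (λ x → inversions f e + toℕ x ≡ toℕ e) fe≡e (inversions-top inv fix))

  zero-inversions⇒fixed : ∀ {f} {m : Fin n} → Involutive f → (∀ k → m ≤ᶠ k → inversions f k ≡ 0) →
    ∀ k → m ≤ᶠ k → f k ≡ k
  zero-inversions⇒fixed {f} inv zero-from k m≤k with <-cmp (toℕ (f k)) (toℕ k)
  ... | tri≈ _ fk≡k _ = toℕ-injective fk≡k
  ... | tri< fk<k _ _ = contradiction (zero-from k m≤k)
          (>⇒≢ (inversions-pos {f} {f k} {k} fk<k (subst (f k <ᶠ_) (sym (inv k)) fk<k)))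
  ... | tri> _ _ k<fk = contradiction (zero-from (f k) (≤-trans m≤k (<⇒≤ k<fk)))
          (>⇒≢ (inversions-pos {f} {k} {f k} k<fk (subst (_<ᶠ f k) (sym (inv k)) k<fk)))

  -- Junk value: the ℕ-indexed sequence is 0 from n on.
  extend : (Fin n → ℕ) → ℕ → ℕ
  extend x k with k ℕ.<? n
  ... | yes k<n = x (fromℕ< k<n)
  ... | no  _   = 0

  extend-fromℕ< : ∀ x {k} (k<n : k < n) → extend x k ≡ x (fromℕ< k<n)
  extend-fromℕ< x {k} k<n with k ℕ.<? n
  ... | yes _   = refl
  ... | no  k≮n = contradiction k<n k≮n

  extend-toℕ : ∀ x i → extend x (toℕ i) ≡ x i
  extend-toℕ x i = trans (extend-fromℕ< x (toℕ<n i)) (cong x (fromℕ<-toℕ i (toℕ<n i)))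

  slow-step : ∀ {x : Fin n → ℕ} → SlowClimbingSeq x →
    ∀ {i j} → toℕ j ≡ suc (toℕ i) → x j ≤ suc (x i)
  slow-step {x} slow {i} {j} adj with x j ℕ.≤? suc (x i)
  ... | yes xj≤1+xi = xj≤1+xi
  ... | no  xj≰1+xi =
    contradiction (adj , <-trans (n<1+n _) (≰⇒> xj≰1+xi) , xj≰1+xi ∘ ≤-reflexive) (slow i j)

  steps⇒slow : ∀ {x : Fin n → ℕ} →
    (∀ i j → toℕ j ≡ suc (toℕ i) → x j ≤ suc (x i)) → SlowClimbingSeq x
  steps⇒slow steps i j (adj , xi<xj , xj≢1+xi) = xj≢1+xi (≤-antisym (steps i j adj) xi<xj)

  extend-slow : ∀ {x} → SlowClimbingSeq x → ∀ k → extend x (suc k) ≤ suc (extend x k)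
  extend-slow {x} slow k with suc k ℕ.<? n
  ... | no  _     = z≤n
  ... | yes 1+k<n = subst (λ t → x (fromℕ< 1+k<n) ≤ suc t) (sym (extend-fromℕ< x k<n))
                      (slow-step slow (trans (toℕ-fromℕ< 1+k<n) (cong suc (sym (toℕ-fromℕ< k<n)))))
    where k<n = <-trans (n<1+n k) 1+k<n

  module _ {f : Fin n → Fin n} {L : Fin n} (f-inv : Involutive f) (f-fix : FixedAbove f L)
           (f-slow : SlowClimbingSeq (inversions f)) where

    private
      p = toℕ (f L)
      ℓ = toℕ L
      p≤ℓ : p ≤ ℓ
      p≤ℓ = fixedAbove-≤ {f} f-inv f-fix {L} ≤-refl

    -- The count is 0 at f L (no value exceeds f (f L) = L) and L − f L at L: it rises at every step.
    slow-involution-climbs : ∀ {i} → f L ≤ᶠ i → i <ᶠ L → ∀ {j} → toℕ j ≡ suc (toℕ i) →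
      inversions f i < inversions f j
    slow-involution-climbs {i} p≤i i<L {j} j≡1+i = subst₂ _<_
      (trans (cong y (m∸n+n≡m p≤i)) (extend-toℕ (inversions f) i))
      (trans (cong (y ∘ suc) (m∸n+n≡m p≤i)) (trans (cong y (sym j≡1+i)) (extend-toℕ (inversions f) j)))
      (climb-steep y (extend-slow f-slow) (ℓ ∸ p) p rise (toℕ i ∸ p) (∸-monoˡ-< i<L p≤i))
      where
      y = extend (inversions f)
      y-p : y p ≡ 0
      y-p = trans (extend-toℕ _ (f L)) (inversions-zero λ j j<fL → subst (f j ≤ᶠ_) (sym (f-inv L))
              (fixedAbove-≤ {f} f-inv f-fix (<⇒≤ (<-≤-trans j<fL p≤ℓ))))
      rise : (ℓ ∸ p) + y p ≤ y ((ℓ ∸ p) + p)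
      rise = ≤-reflexive (begin
        (ℓ ∸ p) + y p           ≡⟨ cong ((ℓ ∸ p) +_) y-p ⟩
        (ℓ ∸ p) + 0             ≡⟨ +-identityʳ _ ⟩
        ℓ ∸ p                   ≡⟨ cong (_∸ p) (inversions-top f-inv f-fix) ⟨
        inversions f L + p ∸ p  ≡⟨ m+n∸n≡m _ p ⟩
        inversions f L          ≡⟨ extend-toℕ _ L ⟨
        y ℓ                     ≡⟨ cong y (m∸n+n≡m p≤ℓ) ⟨
        y ((ℓ ∸ p) + p)         ∎)

    slow-involution-descends : ∀ {i j} → f L ≤ᶠ i → i <ᶠ L → toℕ j ≡ suc (toℕ i) → f j <ᶠ f i
    slow-involution-descends {i} {j} p≤i i<L j≡1+i with <-cmp (toℕ (f i)) (toℕ (f j))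
    ... | tri> _ _ fj<fi = fj<fi
    ... | tri≈ _ fi≡fj _ = contradiction (involutive-injective {f} f-inv (toℕ-injective fi≡fj))
                             (λ i≡j → 1+n≢n (sym (trans (cong toℕ i≡j) j≡1+i)))
    ... | tri< fi<fj _ _ = contradiction (inversions-ascent j≡1+i fi<fj)
                             (<⇒≱ (slow-involution-climbs p≤i i<L j≡1+i))

    slow-involution-reverses : ∀ r → f L ≤ᶠ r → r ≤ᶠ L → toℕ (f r) + toℕ r ≡ p + ℓ
    slow-involution-reverses r p≤r r≤L = begin
      toℕ (f r) + toℕ r                ≡⟨ cong (toℕ (f r) +_) (m∸n+n≡m p≤r) ⟨
      toℕ (f r) + (i + p)              ≡⟨ +-assoc (toℕ (f r)) i p ⟨
      (toℕ (f r) + i) + p              ≡⟨ cong (_+ p) (+-comm (toℕ (f r)) i) ⟩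
      (i + toℕ (f r)) + p              ≡⟨ cong (λ t → (i + t) + p) (extend-toℕ (toℕ ∘ f) r) ⟨
      (i + z (toℕ r)) + p              ≡⟨ cong (λ t → (i + z t) + p) (m∸n+n≡m p≤r) ⟨
      (i + z (i + p)) + p              ≡⟨ cong (_+ p) (descent-exact z (ℓ ∸ p) p desc drop i i≤d) ⟩
      z p + p                          ≡⟨ cong (_+ p) z-p ⟩
      ℓ + p                            ≡⟨ +-comm ℓ p ⟩
      p + ℓ                            ∎
      where
      i = toℕ r ∸ p
      i≤d = ∸-monoˡ-≤ p r≤L
      z = extend (toℕ ∘ f)
      z-p : z p ≡ ℓ
      z-p = trans (extend-toℕ (toℕ ∘ f) (f L)) (cong toℕ (f-inv L))
      drop : z p ≤ (ℓ ∸ p) + z ((ℓ ∸ p) + p)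
      drop = ≤-reflexive (begin
        z p                        ≡⟨ z-p ⟩
        ℓ                          ≡⟨ m∸n+n≡m p≤ℓ ⟨
        (ℓ ∸ p) + p                ≡⟨ cong ((ℓ ∸ p) +_) (extend-toℕ (toℕ ∘ f) L) ⟨
        (ℓ ∸ p) + z ℓ              ≡⟨ cong (λ t → (ℓ ∸ p) + z t) (m∸n+n≡m p≤ℓ) ⟨
        (ℓ ∸ p) + z ((ℓ ∸ p) + p)  ∎)
      desc : ∀ i → i < ℓ ∸ p → z (suc (i + p)) < z (i + p)
      desc i i<d = subst₂ _<_ (sym (extend-fromℕ< (toℕ ∘ f) 1+k<n)) (sym (extend-fromℕ< (toℕ ∘ f) k<n))
        (slow-involution-descends p≤k k<L (trans (toℕ-fromℕ< 1+k<n) (cong suc (sym (toℕ-fromℕ< k<n)))))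
        where
        k<ℓ : i + p < ℓ
        k<ℓ = subst (i + p <_) (m∸n+n≡m p≤ℓ) (+-monoˡ-< p i<d)
        1+k<n = ≤-<-trans k<ℓ (toℕ<n L)
        k<n = <-trans (n<1+n _) 1+k<n
        p≤k : f L ≤ᶠ fromℕ< k<n
        p≤k = subst (p ≤_) (sym (toℕ-fromℕ< k<n)) (m≤n+m p i)
        k<L : fromℕ< k<n <ᶠ L
        k<L = subst (_< ℓ) (sym (toℕ-fromℕ< k<n)) k<ℓ

    module Stretched (m : Fin n) (m≡1+ℓ : toℕ m ≡ suc ℓ) where

      private
        L<m : L <ᶠ m
        L<m = subst (ℓ <_) (sym m≡1+ℓ) (n<1+n ℓ)

        p≤m : p ≤ toℕ m
        p≤m = ≤-trans p≤ℓ (<⇒≤ L<m)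

        fr≢m : ∀ {r} → r <ᶠ m → toℕ (f r) ≢ suc ℓ
        fr≢m {r} r<m fr≡1+ℓ = <-irrefl (cong toℕ r≡m) r<m
          where
          r≡m : r ≡ m
          r≡m = trans (sym (f-inv r))
                  (trans (cong f (toℕ-injective (trans fr≡1+ℓ (sym m≡1+ℓ)))) (f-fix m L<m))

      InBlock : Fin n → Set
      InBlock r = f L ≤ᶠ r × r ≤ᶠ m

      inBlock? : ∀ r → Dec (InBlock r)
      inBlock? r = (p ≤? toℕ r) ×-dec (toℕ r ≤? toℕ m)

      f-inBlock : ∀ {r} → InBlock r → InBlock (f r)
      f-inBlock {r} (p≤r , r≤m) with L <? r
      ... | yes L<r = subst InBlock (sym (f-fix r L<r)) (p≤r , r≤m)
      ... | no  r≮L = let r≤L = ≮⇒≥ r≮L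
                          p≤fr , fr≤ℓ = mirror-bounds (slow-involution-reverses r p≤r r≤L) p≤r r≤L
                      in p≤fr , ≤-trans fr≤ℓ (<⇒≤ L<m)

      f-∉Block : ∀ {r} → ¬ InBlock r → ¬ InBlock (f r)
      f-∉Block {r} r∉ fr∈ = r∉ (subst InBlock (f-inv r) (f-inBlock fr∈))

      mirror<n : ∀ (r : Fin n) → f L ≤ᶠ r → (p + toℕ m) ∸ toℕ r < n
      mirror<n r p≤r = ≤-<-trans (≤-trans (∸-monoˡ-≤ (toℕ r) (+-monoˡ-≤ (toℕ m) p≤r))
                                          (≤-reflexive (m+n∸m≡n (toℕ r) (toℕ m))))
                                 (toℕ<n m)

      stretch : Fin n → Fin n
      stretch r with inBlock? r
      ... | yes (p≤r , _) = fromℕ< (mirror<n r p≤r)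
      ... | no  _         = f r

      stretch-inside : ∀ {r} → InBlock r → toℕ (stretch r) + toℕ r ≡ p + toℕ m
      stretch-inside {r} r∈ with inBlock? r
      ... | yes (p≤r , r≤m) = trans (cong (_+ toℕ r) (toℕ-fromℕ< (mirror<n r p≤r)))
                                    (m∸n+n≡m (≤-trans r≤m (m≤n+m (toℕ m) p)))
      ... | no  r∉          = contradiction r∈ r∉

      stretch-outside : ∀ {r} → ¬ InBlock r → stretch r ≡ f r
      stretch-outside {r} r∉ with inBlock? r
      ... | yes r∈ = contradiction r∈ r∉
      ... | no  _  = refl

      stretch-involutive : Involutive stretch
      stretch-involutive r = involutive-at (inBlock? r)
        where
        involutive-at : Dec (InBlock r) → stretch (stretch r) ≡ r
        involutive-at (yes r∈@(p≤r , r≤m)) = toℕ-injective (+-cancelʳ-≡ (toℕ (stretch r)) _ _ (begin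
          toℕ (stretch (stretch r)) + toℕ (stretch r) ≡⟨ stretch-inside sr∈ ⟩
          p + toℕ m                                   ≡⟨ stretch-inside r∈ ⟨
          toℕ (stretch r) + toℕ r                     ≡⟨ +-comm (toℕ (stretch r)) (toℕ r) ⟩
          toℕ r + toℕ (stretch r)                     ∎))
          where sr∈ = mirror-bounds (stretch-inside r∈) p≤r r≤m
        involutive-at (no r∉) = begin
          stretch (stretch r)  ≡⟨ cong stretch (stretch-outside r∉) ⟩
          stretch (f r)        ≡⟨ stretch-outside (f-∉Block r∉) ⟩
          f (f r)              ≡⟨ f-inv r ⟩
          r                    ∎

      stretch-fixedAbove : FixedAbove stretch m
      stretch-fixedAbove x m<x =
        trans (stretch-outside (λ (_ , x≤m) → <⇒≱ m<x x≤m)) (f-fix x (<-trans L<m m<x))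

      stretch-m : toℕ (stretch m) ≡ p
      stretch-m = +-cancelʳ-≡ (toℕ m) _ _ (stretch-inside (p≤m , ≤-refl))

      -- Below m, stretching acts on values as bump: the block [p, ℓ] of values moves up to [p + 1, m].
      stretch-below : ∀ {r} → r <ᶠ m → toℕ (stretch r) ≡ bump p ℓ (toℕ (f r))
      stretch-below {r} r<m = below-at (inBlock? r)
        where
        r≤L : r ≤ᶠ L
        r≤L = s≤s⁻¹ (subst (toℕ r <_) m≡1+ℓ r<m)
        below-at : Dec (InBlock r) → toℕ (stretch r) ≡ bump p ℓ (toℕ (f r))
        below-at (yes r∈@(p≤r , _)) = trans (+-cancelʳ-≡ (toℕ r) _ _ (begin
            toℕ (stretch r) + toℕ r  ≡⟨ stretch-inside r∈ ⟩
            p + toℕ m                ≡⟨ cong (p +_) m≡1+ℓ ⟩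
            p + suc ℓ                ≡⟨ +-suc p ℓ ⟩
            suc (p + ℓ)              ≡⟨ cong suc fr-reversed ⟨
            suc (toℕ (f r)) + toℕ r  ∎))
          (sym (bump-inside p≤fr fr≤ℓ))
          where
          fr-reversed = slow-involution-reverses r p≤r r≤L
          p≤fr = proj₁ (mirror-bounds fr-reversed p≤r r≤L)
          fr≤ℓ = proj₂ (mirror-bounds fr-reversed p≤r r≤L)
        below-at (no r∉) = trans (cong toℕ (stretch-outside r∉))
          (sym (bump-outside λ (p≤fr , fr≤ℓ) → f-∉Block r∉ (p≤fr , ≤-trans fr≤ℓ (<⇒≤ L<m))))

      inversions-stretch-below : ∀ {k} → k <ᶠ m → inversions stretch k ≡ inversions f k
      inversions-stretch-below {k} k<m = inversions-cong λ j j<k →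
        subst₂ (λ a b → (a < b) ⇔ (f k <ᶠ f j))
          (sym (stretch-below k<m)) (sym (stretch-below (<-trans j<k k<m)))
          (bump-<⇔ (fr≢m k<m) (fr≢m (<-trans j<k k<m)))

      inversions-stretch-above : ∀ {k} → m <ᶠ k → inversions stretch k ≡ 0
      inversions-stretch-above {k} m<k = inversions-fixed stretch-involutive
        (λ x k<x → stretch-fixedAbove x (<-trans m<k k<x)) (stretch-fixedAbove k m<k)

      inversions-stretch-m : inversions stretch m + p ≡ toℕ m
      inversions-stretch-m = subst (λ t → inversions stretch m + t ≡ toℕ m) stretch-m
                               (inversions-top stretch-involutive stretch-fixedAbove)

      stretch-slow : SlowClimbingSeq (inversions stretch)
      stretch-slow = steps⇒slow λ i j j≡1+i → step j≡1+i (<-cmp (toℕ j) (toℕ m))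
        where
        step-into-m : ∀ {i} → toℕ i ≡ ℓ → inversions stretch m ≡ suc (inversions stretch i)
        step-into-m {i} i≡ℓ = +-cancelʳ-≡ p _ _ (begin
          inversions stretch m + p        ≡⟨ inversions-stretch-m ⟩
          toℕ m                           ≡⟨ m≡1+ℓ ⟩
          suc ℓ                           ≡⟨ cong suc (inversions-top f-inv f-fix) ⟨
          suc (inversions f L + p)        ≡⟨ cong (λ t → suc (inversions f t + p)) (toℕ-injective i≡ℓ) ⟨
          suc (inversions f i + p)        ≡⟨ cong (λ t → suc (t + p)) (inversions-stretch-below i<m) ⟨
          suc (inversions stretch i) + p  ∎)
          where
          i<m : i <ᶠ m
          i<m = subst (_< toℕ m) (sym i≡ℓ) L<m
        step : ∀ {i j} → toℕ j ≡ suc (toℕ i) → Tri (j <ᶠ m) (toℕ j ≡ toℕ m) (m <ᶠ j) →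
          inversions stretch j ≤ suc (inversions stretch i)
        step {i} j≡1+i (tri< j<m _ _) = subst₂ (λ a b → a ≤ suc b)
          (sym (inversions-stretch-below j<m))
          (sym (inversions-stretch-below (<-trans (subst (toℕ i <_) (sym j≡1+i) (n<1+n _)) j<m)))
          (slow-step f-slow j≡1+i)
        step {i} {j} j≡1+i (tri≈ _ j≡m _) rewrite toℕ-injective j≡m =
          ≤-reflexive (step-into-m (suc-injective (trans (sym j≡1+i) m≡1+ℓ)))
        step j≡1+i (tri> _ _ m<j) = subst (_≤ suc _) (sym (inversions-stretch-above m<j)) z≤n

  module _ {g f : Fin n → Fin n} {m : Fin n}
           (g-inv : Involutive g) (gm≢m : g m ≢ m) (g-fix : FixedAbove g m)
           (f-inv : Involutive f) (f-slow : SlowClimbingSeq (inversions f))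
           (f≤g : ∀ k → inversions f k ≤ inversions g k) (f-m : inversions f m ≡ 0) where

    private
      gm<m : g m <ᶠ m
      gm<m with <-cmp (toℕ (g m)) (toℕ m)
      ... | tri< gm<m _ _ = gm<m
      ... | tri≈ _ gm≡m _ = contradiction (toℕ-injective gm≡m) gm≢m
      ... | tri> _ _ m<gm = contradiction (trans (sym (g-fix (g m) m<gm)) (g-inv m)) gm≢m

      L : Fin n
      L = fromℕ< (≤-<-trans (m∸n≤m (toℕ m) 1) (toℕ<n m))

      m≡1+L : toℕ m ≡ suc (toℕ L)
      m≡1+L = trans (sym (m∸n+n≡m (≤-trans (s≤s z≤n) gm<m)))
                    (trans (+-comm _ 1) (cong suc (sym (toℕ-fromℕ< _))))

      f-zero-from-m : ∀ k → m ≤ᶠ k → inversions f k ≡ 0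
      f-zero-from-m k m≤k with m≤n⇒m<n∨m≡n m≤k
      ... | inj₂ m≡k = subst (λ t → inversions f t ≡ 0) (toℕ-injective m≡k) f-m
      ... | inj₁ m<k = n≤0⇒n≡0 (subst (inversions f k ≤_)
              (inversions-fixed g-inv (λ x k<x → g-fix x (<-trans m<k k<x)) (g-fix k m<k)) (f≤g k))

      f-fix : FixedAbove f L
      f-fix x L<x = zero-inversions⇒fixed {f} f-inv f-zero-from-m x (subst (_≤ toℕ x) (sym m≡1+L) L<x)

      -- Were g m above f L, position g m would carry an inversion of f (against f L) but none of g.
      gm≤fL : toℕ (g m) ≤ toℕ (f L)
      gm≤fL = ≮⇒≥ λ fL<gm → <⇒≱ (inversions-pos {f} {f L} {g m} fL<gm (fgm<ffL fL<gm))
                                 (subst (inversions f (g m) ≤_) inversions-g-gm (f≤g (g m)))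
        where
        inversions-g-gm : inversions g (g m) ≡ 0
        inversions-g-gm = inversions-zero λ j j<gm →
          subst (g j ≤ᶠ_) (sym (g-inv m)) (fixedAbove-≤ {g} g-inv g-fix (<⇒≤ (<-trans j<gm gm<m)))
        fgm<ffL : f L <ᶠ g m → f (g m) <ᶠ f (f L)
        fgm<ffL fL<gm = subst (toℕ (f (g m)) <_) (cong toℕ (sym (f-inv L)))
          (mirror-< (slow-involution-reverses f-inv f-fix f-slow (g m) (<⇒≤ fL<gm)
                      (s≤s⁻¹ (subst (toℕ (g m) <_) m≡1+L gm<m))) fL<gm)

    larger-slow-involution :
      ∃ λ h → Involutive h × SlowClimbingSeq (inversions h)
            × (∀ k → inversions h k ≤ inversions g k) × (∀ k → inversions f k ≤ inversions h k)
            × 0 < inversions h m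
    larger-slow-involution =
      stretch , stretch-involutive , stretch-slow , stretch≤g , f≤stretch , stretch-m-pos
      where
      open Stretched {f} {L} f-inv f-fix f-slow m m≡1+L
      stretch≤g : ∀ k → inversions stretch k ≤ inversions g k
      stretch≤g k with <-cmp (toℕ k) (toℕ m)
      ... | tri< k<m _ _ = subst (_≤ inversions g k) (sym (inversions-stretch-below k<m)) (f≤g k)
      ... | tri> _ _ m<k = subst (_≤ inversions g k) (sym (inversions-stretch-above m<k)) z≤n
      ... | tri≈ _ k≡m _ rewrite toℕ-injective k≡m = +-cancelʳ-≤ (toℕ (f L)) _ _
        (≤-trans (≤-reflexive (trans inversions-stretch-m (sym (inversions-top g-inv g-fix))))
                 (+-monoʳ-≤ (inversions g m) gm≤fL))
      f≤stretch : ∀ k → inversions f k ≤ inversions stretch k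
      f≤stretch k with <-cmp (toℕ k) (toℕ m)
      ... | tri< k<m _ _ = ≤-reflexive (sym (inversions-stretch-below k<m))
      ... | tri≈ _ k≡m _ =
        subst (_≤ inversions stretch k) (sym (f-zero-from-m k (≤-reflexive (sym k≡m)))) z≤n
      ... | tri> _ _ m<k = subst (_≤ inversions stretch k) (sym (f-zero-from-m k (<⇒≤ m<k))) z≤n
      stretch-m-pos : 0 < inversions stretch m
      stretch-m-pos = inversions-pos {stretch} {L} {m} L<m (subst₂ _<_ (sym stretch-m)
        (sym (trans (stretch-below L<m) (bump-inside ≤-refl (fixedAbove-≤ {f} f-inv f-fix ≤-refl))))
        (n<1+n _))
        where
        L<m : L <ᶠ m
        L<m = subst (toℕ L <_) (sym m≡1+L) (n<1+n _)

lemma5p5 : ∀ (n : ℕ) (w : Permutation′ n) → IsInvolution w → ¬ IsIdentity w →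
    ∃ λ (i : Fin n) → ∀ (v : Permutation′ n) → InM w v → I v i ≢ 0
lemma5p5 n w w-inv w≢id = m , v-moves-m
  where
  w-moves : ¬ (∀ i → w ⟨$⟩ˡ i ≡ i)
  w-moves fixed = w≢id λ i → trans (sym (involution-from≗to {π = w} w-inv i)) (fixed i)
  last-moved = last-counterexample (λ i → w ⟨$⟩ˡ i ≟ i) w-moves
  m = proj₁ last-moved
  v-moves-m : ∀ v → InM w v → I v m ≢ 0
  v-moves-m v ((v-slow , v-inv , v≤w) , v-max) v-m≡0
    with larger-slow-involution {g = w ⟨$⟩ˡ_} {f = v ⟨$⟩ˡ_} (involution-involutive {π = w} w-inv)
           (proj₁ (proj₂ last-moved)) (proj₂ (proj₂ last-moved))
           (involution-involutive {π = v} v-inv) v-slow v≤w v-m≡0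
  ... | h , h-inv , h-slow , h≤w , v≤h , h-m>0 =
    <⇒≱ h-m>0 (subst (inversions h m ≤_) v-m≡0 (v-max (involution h h-inv) (h-slow , h-inv , h≤w) v≤h m))
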